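{- A (deterministic) online algorithm for the Online Set Cover problem is priceable if and only if it is monotone.
   Context: Online Set Cover (OSC): a finite universe $X$, a family $\mathcal{S}\subseteq\mathcal{P}(X)$ of sets with costs $c_S>0$, $\mathcal{S}_\eta=\{S\in\mathcal{S}:\eta\in S\}$. Elements are requested online; when an uncovered element $\eta$ is requested the algorithm must irrevocably purchase a set in $\mathcal{S}_\eta$ (covered elements require no action). At any moment just before the next request, an online algorithm determines an assignment scheme: the map $\mathcal{A}$ sending each currently uncovered element $\eta$ to the set $\mathcal{A}(\eta)\in\mathcal{S}_\eta$ the algorithm would purchase if $\eta$ were the next request; write $\eta\to_{\mathcal{A}}T$ for $\mathcal{A}(\eta)=T$. The preference graph of $\mathcal{A}$ is the directed graph on vertex set $\mathcal{S}$ with an edge $(S,T)$, $S\neq T$, whenever some uncovered $\eta\in S\cap T$ has $\eta\to_{\mathcal{A}}T$. An algorithm is monotone if every assignment scheme it determines (at every moment, on every input) has an acyclic preference graph. Dynamic pricing: before each request a pricing algorithm (depending on the history so far) sets surcharges $\rho(S)\ge 0$ for all $S\in\mathcal{S}$; the price is $\pi(S)=\rho(S)+c_S$; a client requesting an uncovered element $\eta$ purchases the set of $\mathcal{S}_\eta$ minimizing $\pi$. An algorithm is priceable if there is a dynamic pricing algorithm that mimics it: at every moment, for every currently uncovered element $\eta$, the set $\mathcal{A}(\eta)$ is the unique minimizer of $\pi$ over $\mathcal{S}_\eta$, so that the clients' choices coincide with the algorithm's.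
   Formalization: The set costs $c_S$ and the surcharges $\rho(S)$ set by the dynamic pricing are rational. -}

module Defs where

open import Data.Nat using (ℕ)
open import Data.Fin using (Fin)
open import Data.Fin.Subset using (Subset; _∈_)
open import Data.Fin.Subset.Properties using (_∈?_)
open import Data.List using (List; []; _∷_)
open import Data.List.Relation.Unary.Any using (Any; any?)
open import Data.Rational using (ℚ; 0ℚ; _<_; _≤_; _+_)
open import Data.Bool using (if_then_else_)
open import Data.Product using (Σ; ∃; _×_)
open import Relation.Nullary using (¬_; does)
open import Relation.Binary.PropositionalEquality using (_≡_; _≢_)
open import Relation.Binary.Construct.Closure.Transitive using (TransClosure)

-- An OSC instance: universe X = Fin n, the family 𝒮 is indexed by Fin m,
-- `set S : Subset n` is the set with index S (costs are passed separately).
-- A history is the list of requests made so far, MOST RECENT FIRST.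
module _ {n m : ℕ} (set : Fin m → Subset n) where

  CoveredBy : List (Fin m) → Fin n → Set
  CoveredBy bought η = Any (λ S → η ∈ set S) bought

  Purchased : (List (Fin n) → Fin n → Fin m) → List (Fin n) → List (Fin m)
  Purchased choose [] = []
  Purchased choose (r ∷ h) =
    if does (any? (λ S → r ∈? set S) (Purchased choose h))
    then Purchased choose h
    else (choose h r ∷ Purchased choose h)

  Uncovered : (List (Fin n) → Fin n → Fin m) → List (Fin n) → Fin n → Set
  Uncovered choose h η = ¬ CoveredBy (Purchased choose h) η

  -- A deterministic online algorithm: after history h, on request of an
  -- uncovered η it purchases `choose h η ∈ 𝒮_η`.
  -- The assignment scheme at moment h is  η ↦ choose h η  on uncovered η.
  record OnlineAlgorithm : Set where
    field
      choose   : List (Fin n) → Fin n → Fin m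
      feasible : ∀ h η → Uncovered choose h η → η ∈ set (choose h η)

  open OnlineAlgorithm

  PrefEdge : OnlineAlgorithm → List (Fin n) → Fin m → Fin m → Set
  PrefEdge A h S T =
    S ≢ T × ∃ (λ η → Uncovered (choose A) h η × η ∈ set S × η ∈ set T × choose A h η ≡ T)

  Acyclic : (Fin m → Fin m → Set) → Set
  Acyclic E = ∀ S → ¬ TransClosure E S S

  Monotone : OnlineAlgorithm → Set
  Monotone A = ∀ h → Acyclic (PrefEdge A h)

  -- dynamic pricing: surcharges ρ h S ≥ 0 depending on the history;
  -- price π = ρ + c; the algorithm's choice must be the unique minimiser of
  -- the price over 𝒮_η for every uncovered η
  -- (membership of choose h η in 𝒮_η is OnlineAlgorithm.feasible).
  Priceable : (Fin m → ℚ) → OnlineAlgorithm → Set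
  Priceable cost A =
    Σ (List (Fin n) → Fin m → ℚ) λ ρ →
      (∀ h S → 0ℚ ≤ ρ h S) ×
      (∀ h η → Uncovered (choose A) h η → ∀ S → η ∈ set S → S ≢ choose A h η →
         ρ h (choose A h η) + cost (choose A h η) < ρ h S + cost S)

{-# OPTIONS --safe #-}
module Submission where

-- A price that strictly drops along every preference edge rules out cycles.
-- Conversely, if the preference graph at some moment is acyclic, rank each set
-- by the length of a longest walk leaving it, so that every preference edge
-- S → T has rank T < rank S. Pricing each set at (rank + 1) · max(1, max cost)
-- then makes the algorithm's choice the unique cheapest set, with nonnegative
-- surcharges.

open import Defs
open import Data.Nat using (ℕ)
open import Data.Fin using (Fin)
open import Data.Fin.Subset using (Subset)
open import Data.Rational using (ℚ; 0ℚ; _<_)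
open import Function.Definitions using (Injective)
open import Function.Bundles using (_⇔_)
open import Relation.Binary.PropositionalEquality using (_≡_)

open import Data.Nat as ℕ using (zero; suc; z≤n; s≤s; _≤′_; ≤′-refl; ≤′-step)
import Data.Nat.Properties as ℕ
open import Data.Fin as Fin using (zero; suc)
open import Data.Fin.Properties as Fin using (any?; pigeonhole)
open import Data.Fin.Subset using (_∈_)
open import Data.Fin.Subset.Properties using (_∈?_)
open import Data.List using (List; allFin; map)
open import Data.List.Membership.Propositional.Properties using (∈-map⁺; ∈-allFin)
open import Data.List.Relation.Unary.All as All using ()
import Data.List.Relation.Unary.Any as Any
import Data.List.Extrema
open import Data.Rational as ℚ using (1ℚ; _≤_; _+_; _-_)
import Data.Rational.Properties as ℚ
open import Algebra.Properties.Group ℚ.+-0-group using (//-rightDividesˡ)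
open import Relation.Binary.Bundles using (DecTotalOrder)
open import Data.Product using (∃; _,_; proj₁; proj₂)
open import Data.Sum using (inj₁; inj₂)
open import Data.Empty using (⊥-elim)
open import Function using (mk⇔)
open import Level using (0ℓ)
open import Relation.Binary.Core using (Rel)
open import Relation.Binary.Definitions using (Decidable)
open import Relation.Binary.PropositionalEquality using (_≢_; refl; sym; subst; subst₂)
open import Relation.Binary.Construct.Closure.Transitive using (TransClosure; [_]; _∷_)
open import Relation.Nullary using (¬_; Dec; yes; no; ¬?)
open import Relation.Nullary.Decidable using (_×-dec_; map′)

module _ {A : Set} {E : Rel A 0ℓ} where

  descending⇒acyclic : (f : A → ℚ) → (∀ {S T} → E S T → f T < f S) →
                       ∀ S → ¬ TransClosure E S S
  descending⇒acyclic f descending S cycle = ℚ.<-irrefl refl (descent cycle)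
    where
    descent : ∀ {S T} → TransClosure E S T → f T < f S
    descent [ e ]    = descending e
    descent (e ∷ es) = ℚ.<-trans (descent es) (descending e)

module _ {m : ℕ} (E : Rel (Fin m) 0ℓ) where

  infixr 5 _◅_

  data Walk : ℕ → Fin m → Set where
    []  : ∀ {S} → Walk 0 S
    _◅_ : ∀ {S T j} → E S T → Walk j T → Walk (suc j) S

  vertex : ∀ {j S} → Walk j S → Fin (suc j) → Fin m
  vertex {S = S} _ zero    = S
  vertex (_ ◅ w)   (suc i) = vertex w i

  vertex-path : ∀ {j S} (w : Walk j S) {i k} → i Fin.< k →
                TransClosure E (vertex w i) (vertex w k)
  vertex-path (e ◅ w) {zero}  {suc zero}    _         = [ e ]
  vertex-path (e ◅ w) {zero}  {suc (suc k)} _         = e ∷ vertex-path w {zero} {suc k} (s≤s z≤n)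
  vertex-path (e ◅ w) {suc i} {suc k}       (s≤s i<k) = vertex-path w i<k

  -- A walk with m edges visits m + 1 vertices, so by pigeonhole it contains a cycle.
  acyclic⇒¬walk : (∀ S → ¬ TransClosure E S S) → ∀ {S} → ¬ Walk m S
  acyclic⇒¬walk acyclic w with pigeonhole (ℕ.n<1+n m) (vertex w)
  ... | i , k , i<k , same = acyclic _ (subst (TransClosure E _) (sym same) (vertex-path w i<k))

  module _ (E? : Decidable E) where

    walk? : ∀ j S → Dec (Walk j S)
    walk? zero    S = yes []
    walk? (suc j) S = map′ (λ (_ , e , w) → e ◅ w) (λ { (e ◅ w) → _ , e , w })
                           (any? λ T → E? S T ×-dec walk? j T)

    longest : ℕ → Fin m → ℕ
    longest zero    S = 0
    longest (suc b) S with walk? (suc b) S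
    ... | yes _ = suc b
    ... | no  _ = longest b S

    longest-walk : ∀ b S → Walk (longest b S) S
    longest-walk zero    S = []
    longest-walk (suc b) S with walk? (suc b) S
    ... | yes w = w
    ... | no  _ = longest-walk b S

    longest≤bound : ∀ b S → longest b S ℕ.≤ b
    longest≤bound zero    S = z≤n
    longest≤bound (suc b) S with walk? (suc b) S
    ... | yes _ = ℕ.≤-refl
    ... | no  _ = ℕ.m≤n⇒m≤1+n (longest≤bound b S)

    walk⇒≤longest : ∀ {j b S} → Walk j S → j ℕ.≤ b → j ℕ.≤ longest b S
    walk⇒≤longest {zero}              _ _   = z≤n
    walk⇒≤longest {suc j} {suc b} {S} w j≤b with walk? (suc b) S
    ... | yes _ = j≤b
    ... | no ¬w with ℕ.m≤n⇒m<n∨m≡n j≤b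
    ...   | inj₁ (s≤s j<b) = walk⇒≤longest w j<b
    ...   | inj₂ refl      = ⊥-elim (¬w w)

    acyclic⇒rank : (∀ S → ¬ TransClosure E S S) →
                   ∃ λ (rank : Fin m → ℕ) → ∀ {S T} → E S T → rank T ℕ.< rank S
    acyclic⇒rank acyclic = longest m , λ {T = T} e →
      walk⇒≤longest (e ◅ longest-walk m T) (longest<m T)
      where
      longest<m : ∀ T → longest m T ℕ.< m
      longest<m T = ℕ.≤∧≢⇒< (longest≤bound m T)
        λ same → acyclic⇒¬walk acyclic (subst (λ j → Walk j T) same (longest-walk m T))

module _ (C : ℚ) (C>0 : 0ℚ < C) where

  level : ℕ → ℚ
  level zero    = C
  level (suc r) = level r + C

  level<level-suc : ∀ r → level r < level (suc r)
  level<level-suc r =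
    subst (_< level r + C) (ℚ.+-identityʳ (level r)) (ℚ.+-monoʳ-< (level r) C>0)

  level-mono-≤′ : ∀ {r s} → r ≤′ s → level r ≤ level s
  level-mono-≤′ ≤′-refl             = ℚ.≤-refl
  level-mono-≤′ (≤′-step {s} r≤′s) = ℚ.≤-trans (level-mono-≤′ r≤′s) (ℚ.<⇒≤ (level<level-suc s))

  level-mono-< : ∀ {r s} → r ℕ.< s → level r < level s
  level-mono-< {r} r<s = ℚ.<-≤-trans (level<level-suc r) (level-mono-≤′ (ℕ.≤⇒≤′ r<s))

  C≤level : ∀ r → C ≤ level r
  C≤level r = level-mono-≤′ {0} {r} (ℕ.≤⇒≤′ z≤n)

module _ {n m : ℕ} (set : Fin m → Subset n) (cost : Fin m → ℚ) (A : OnlineAlgorithm set) where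
  open OnlineAlgorithm A

  priceable⇒monotone : Priceable set cost A → Monotone set A
  priceable⇒monotone (ρ , _ , cheapest) h = descending⇒acyclic (λ S → ρ h S + cost S) cheaper
    where
    cheaper : ∀ {S T} → PrefEdge set A h S T → ρ h T + cost T < ρ h S + cost S
    cheaper (S≢T , η , uncovered , η∈S , _ , refl) = cheapest h η uncovered _ η∈S S≢T

  uncovered? : ∀ h η → Dec (Uncovered set choose h η)
  uncovered? h η = ¬? (Any.any? (λ S → η ∈? set S) (Purchased set choose h))

  prefEdge? : ∀ h → Decidable (PrefEdge set A h)
  prefEdge? h S T = ¬? (S Fin.≟ T) ×-dec any? λ η →
    uncovered? h η ×-dec η ∈? set S ×-dec η ∈? set T ×-dec choose h η Fin.≟ T

  open Data.List.Extrema (DecTotalOrder.totalOrder ℚ.≤-decTotalOrder) using (max; ⊥≤max; xs≤max)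

  maxCost : ℚ
  maxCost = max 1ℚ (map cost (allFin m))

  cost≤maxCost : ∀ S → cost S ≤ maxCost
  cost≤maxCost S = All.lookup (xs≤max 1ℚ _) (∈-map⁺ cost (∈-allFin S))

  maxCost>0 : 0ℚ < maxCost
  maxCost>0 = ℚ.<-≤-trans (ℚ.positive⁻¹ 1ℚ) (⊥≤max 1ℚ (map cost (allFin m)))

  monotone⇒priceable : Monotone set A → Priceable set cost A
  monotone⇒priceable monotone = ρ , ρ≥0 , cheapest
    where
    ranking : ∀ h → ∃ λ (rank : Fin m → ℕ) → ∀ {S T} → PrefEdge set A h S T → rank T ℕ.< rank S
    ranking h = acyclic⇒rank (PrefEdge set A h) (prefEdge? h) (monotone h)

    rank : List (Fin n) → Fin m → ℕ
    rank h = proj₁ (ranking h)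

    price : List (Fin n) → Fin m → ℚ
    price h S = level maxCost maxCost>0 (rank h S)

    ρ : List (Fin n) → Fin m → ℚ
    ρ h S = price h S - cost S

    ρ+cost≡price : ∀ h S → ρ h S + cost S ≡ price h S
    ρ+cost≡price h S = //-rightDividesˡ (cost S) (price h S)

    ρ≥0 : ∀ h S → 0ℚ ≤ ρ h S
    ρ≥0 h S = subst (_≤ ρ h S) (ℚ.+-inverseʳ (cost S))
      (ℚ.+-monoˡ-≤ (ℚ.- cost S)
        (ℚ.≤-trans (cost≤maxCost S) (C≤level maxCost maxCost>0 (rank h S))))

    cheapest : ∀ h η → Uncovered set choose h η → ∀ S → η ∈ set S → S ≢ choose h η →
               ρ h (choose h η) + cost (choose h η) < ρ h S + cost S
    cheapest h η uncovered S η∈S S≢choice =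
      subst₂ _<_ (sym (ρ+cost≡price h _)) (sym (ρ+cost≡price h S))
        (level-mono-< maxCost maxCost>0
          (proj₂ (ranking h) (S≢choice , η , uncovered , η∈S , feasible h η uncovered , refl)))

theorem2 : ∀ {n m : ℕ} (set : Fin m → Subset n) → Injective _≡_ _≡_ set →
           (cost : Fin m → ℚ) → (∀ S → 0ℚ < cost S) →
           (A : OnlineAlgorithm set) →
           Priceable set cost A ⇔ Monotone set A
theorem2 set _ cost _ A = mk⇔ (priceable⇒monotone set cost A) (monotone⇒priceable set cost A)
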